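{- Let $n\ge 4$ and let $\mathbf D\subseteq\mathbf T$ be a super-domain (a set of tilings on the color set $[n]$). Then $\mathbf D$ is a Condorcet super-domain if and only if for every quadruple $F=\{i<j<k<l\}\subseteq[n]$ the restriction $\mathbf D|_F=\{T\cap\Lambda^3(F): T\in\mathbf D\}$ is a Condorcet super-domain (of tilings on the color set $F$).
   Context: Fix an integer $n\ge 2$ and let $[n]=\{1,\dots,n\}$ (elements are called colors). For a set $K\subseteq[n]$ of colors, let $\Lambda^3(K)$ be the set of triples $ijk$ with $i<j<k$ in $K$; write $\Lambda=\Lambda^3([n])$. For a quadruple $F=\{i<j<k<l\}$, its stick is the ordered sequence of four triples $(ijk,\,ijl,\,ikl,\,jkl)$, whose underlying set is $\Lambda^3(F)$. Any subset of $\Lambda^3(K)$ is a pseudo-tiling on $K$. A pseudo-tiling $T\subseteq\Lambda^3(K)$ is a tiling (on $K$) if for every quadruple $F\subseteq K$, the intersection $T\cap\Lambda^3(F)$, written as a 0/1 string of length 4 along the stick order $(ijk,ijl,ikl,jkl)$, is one of $0000,1000,1100,1110,1111,0111,0011,0001$ (equivalently, both the ones and the zeros form consecutive blocks). (By Ziegler's theorem these are exactly the inversion sets of rhombus tilings of the zonogon $Z(|K|;2)$, a rhombus tiling being identified with its set of inversions, i.e. triples on which its restriction is anti-standard.) Let $\mathbf T$ be the set of tilings on $[n]$; a super-domain is any subset of $\mathbf T$. Majority rule: for a finite set $V$ of odd cardinality and a family $(T_v)_{v\in V}$ of tilings (repetitions allowed), $sm((T_v)_{v\in V})=\{ijk: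 |\{v\in V: ijk\in T_v\}|>|V|/2\}$. A super-domain $\mathbf D$ (on a color set $K$) is a Condorcet super-domain (CSD) if for every finite set $V$ of odd cardinality and every family $(T_v)_{v\in V}$ with all $T_v\in\mathbf D$, the pseudo-tiling $sm((T_v)_{v\in V})$ is a tiling. -}

module Defs where

open import Data.Bool using (Bool; true; false; _∧_; _∨_)
open import Data.Nat using (ℕ; zero; suc; _+_; _*_; _<_)
open import Data.Nat.DivMod using (_%_)
open import Data.Fin using (Fin) renaming (zero to fzero; suc to fsuc; _<_ to _<ᶠ_)
import Data.Fin as Fin
open import Data.List using (List; []; _∷_)
open import Data.List.Membership.Propositional using (_∈_)
open import Data.Product using (Σ; _×_; _,_)
open import Relation.Binary.PropositionalEquality using (_≡_)
open import Relation.Nullary.Decidable using (⌊_⌋)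
open import Function.Bundles using (_⇔_)

-- Colors are elements of Fin n (color c corresponds to c+1 ∈ [n]).
-- A set of colors K ⊆ [n] is given by its characteristic function.
ColorSet : ℕ → Set
ColorSet n = Fin n → Bool

allColors : ∀ {n} → ColorSet n
allColors _ = true

quad : ∀ {n} → Fin n → Fin n → Fin n → Fin n → ColorSet n
quad i j k l x = ⌊ x Fin.≟ i ⌋ ∨ ⌊ x Fin.≟ j ⌋ ∨ ⌊ x Fin.≟ k ⌋ ∨ ⌊ x Fin.≟ l ⌋

-- A pseudo-tiling: a set of triples, given by a characteristic function
-- (T i j k ≡ true means ijk ∈ T).  Only values with i < j < k are meaningful;
-- all notions below only ever inspect such values.
PT : ℕ → Set
PT n = Fin n → Fin n → Fin n → Bool

data Str4 : Set where
  str : Bool → Bool → Bool → Bool → Str4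

allowedStrings : List Str4
allowedStrings =
  str false false false false ∷ str true false false false ∷
  str true true false false ∷ str true true true false ∷
  str true true true true ∷ str false true true true ∷
  str false false true true ∷ str false false false true ∷ []

IsPseudoTilingOn : ∀ {n} → ColorSet n → PT n → Set
IsPseudoTilingOn {n} K T =
  (i j k : Fin n) → i <ᶠ j → j <ᶠ k → T i j k ≡ true →
  (K i ≡ true) × (K j ≡ true) × (K k ≡ true)

IsTilingOn : ∀ {n} → ColorSet n → PT n → Set
IsTilingOn {n} K T =
  IsPseudoTilingOn K T ×
  ((i j k l : Fin n) → i <ᶠ j → j <ᶠ k → k <ᶠ l →
   K i ≡ true → K j ≡ true → K k ≡ true → K l ≡ true →
   str (T i j k) (T i j l) (T i k l) (T j k l) ∈ allowedStrings)

IsTiling : ∀ {n} → PT n → Set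
IsTiling = IsTilingOn allColors

-- A super-domain is a subset of pseudo-tilings (given as a predicate);
-- being a subset of the tilings is imposed separately where needed.
SuperDomain : ℕ → Set₁
SuperDomain n = PT n → Set

countTrue : (m : ℕ) → (Fin m → Bool) → ℕ
countTrue zero b = 0
countTrue (suc m) b with b fzero
... | true  = suc (countTrue m (λ v → b (fsuc v)))
... | false = countTrue m (λ v → b (fsuc v))

-- Majority rule for a family (T_v)_{v ∈ Fin m}:
-- ijk ∈ sm iff |{v : ijk ∈ T_v}| > m/2, i.e. 2·count > m.
sm : ∀ {n} (m : ℕ) → (Fin m → PT n) → PT n
sm m Ts i j k = ⌊ m Data.Nat.<? 2 * countTrue m (λ v → Ts v i j k) ⌋

-- D is a Condorcet super-domain on the color set K: for every finite odd
-- set of voters (w.l.o.g. Fin m with m odd) and every family of members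
-- of D, the majority pseudo-tiling is a tiling on K.
IsCSDOn : ∀ {n} → ColorSet n → SuperDomain n → Set
IsCSDOn {n} K D =
  (m : ℕ) → m % 2 ≡ 1 → (Ts : Fin m → PT n) → ((v : Fin m) → D (Ts v)) →
  IsTilingOn K (sm m Ts)

restrictPT : ∀ {n} → ColorSet n → PT n → PT n
restrictPT K T i j k = T i j k ∧ K i ∧ K j ∧ K k

restrictSD : ∀ {n} → ColorSet n → SuperDomain n → SuperDomain n
restrictSD K D S = Σ _ (λ T → D T × (S ≡ restrictPT K T))

-- Majority rule commutes with restriction to a color set K: a restricted
-- voter T ∩ Λ³(K) contains ijk iff T does and ijk ⊆ K, so the majority of
-- the restricted profile is the restriction of the majority.  Since being a
-- tiling is a condition on each quadruple separately, and on a quadruple F a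
-- pseudo-tiling and its restriction to F have the same stick, the majority
-- is a tiling on [n] iff all its restrictions to quadruples are tilings on
-- them.
module Submission where

open import Defs
open import Data.Nat using (ℕ; _≤_)
open import Data.Fin using (Fin; _<_)
open import Function.Bundles using (_⇔_)

open import Data.Bool using (Bool; true; false; _∧_)
open import Data.Bool.Properties using (∧-identityʳ; ∧-zeroʳ; ∨-zeroʳ)
import Data.Nat as ℕ
open import Data.Nat.Properties using (n≮0)
import Data.Fin as Fin
open import Data.Fin using () renaming (zero to fzero; suc to fsuc)
open import Data.Product using (_,_; proj₁; proj₂)
open import Data.List.Membership.Propositional using (_∈_)
open import Relation.Binary.PropositionalEquality
  using (_≡_; refl; sym; trans; cong; subst; module ≡-Reasoning)
open import Relation.Nullary.Decidable using (⌊_⌋; isYes≗does; dec-true; dec-false)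
open import Function.Bundles using (mk⇔; module Equivalence)

private
  variable
    n m : ℕ

_⊆_ : ColorSet n → ColorSet n → Set
K ⊆ L = ∀ x → K x ≡ true → L x ≡ true

majority : (m : ℕ) → (Fin m → Bool) → Bool
majority m b = ⌊ m ℕ.<? 2 ℕ.* countTrue m b ⌋

countTrue-cong : (f g : Fin m → Bool) → (∀ v → f v ≡ g v) →
  countTrue m f ≡ countTrue m g
countTrue-cong {ℕ.zero}  f g f≗g = refl
countTrue-cong {ℕ.suc m} f g f≗g with f fzero | g fzero | f≗g fzero
... | true  | .true  | refl = cong ℕ.suc (countTrue-cong _ _ (λ v → f≗g (fsuc v)))
... | false | .false | refl = countTrue-cong _ _ (λ v → f≗g (fsuc v))

countTrue-false : (m : ℕ) → countTrue m (λ _ → false) ≡ 0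
countTrue-false ℕ.zero    = refl
countTrue-false (ℕ.suc m) = countTrue-false m

majority-cong : (f g : Fin m → Bool) → (∀ v → f v ≡ g v) →
  majority m f ≡ majority m g
majority-cong {m} f g f≗g = cong (λ c → ⌊ m ℕ.<? 2 ℕ.* c ⌋) (countTrue-cong f g f≗g)

majority-∧ʳ : (f : Fin m → Bool) (q : Bool) →
  majority m (λ v → f v ∧ q) ≡ majority m f ∧ q
majority-∧ʳ {m} f true = trans
  (majority-cong _ f (λ v → ∧-identityʳ (f v)))
  (sym (∧-identityʳ (majority m f)))
majority-∧ʳ {m} f false = begin
  majority m (λ v → f v ∧ false) ≡⟨ majority-cong _ (λ _ → false) (λ v → ∧-zeroʳ (f v)) ⟩
  majority m (λ _ → false)      ≡⟨ cong (λ c → ⌊ m ℕ.<? 2 ℕ.* c ⌋) (countTrue-false m) ⟩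
  ⌊ m ℕ.<? 0 ⌋                  ≡⟨ trans (isYes≗does (m ℕ.<? 0)) (dec-false (m ℕ.<? 0) n≮0) ⟩
  false                         ≡⟨ sym (∧-zeroʳ (majority m f)) ⟩
  majority m f ∧ false          ∎
  where open ≡-Reasoning

sm-restrictPT : (K : ColorSet n) (Ts : Fin m → PT n) (a b c : Fin n) →
  sm m (λ v → restrictPT K (Ts v)) a b c ≡ restrictPT K (sm m Ts) a b c
sm-restrictPT K Ts a b c = majority-∧ʳ (λ v → Ts v a b c) (K a ∧ K b ∧ K c)

restrictPT-inside : (K : ColorSet n) (T : PT n) {a b c : Fin n} →
  K a ≡ true → K b ≡ true → K c ≡ true → restrictPT K T a b c ≡ T a b c
restrictPT-inside K T {a} {b} {c} ka kb kc rewrite ka | kb | kc = ∧-identityʳ (T a b c)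

∧-elimˡ : {x y : Bool} → x ∧ y ≡ true → x ≡ true
∧-elimˡ {true} _ = refl

∧-elimʳ : {x y : Bool} → x ∧ y ≡ true → y ≡ true
∧-elimʳ {true} y≡true = y≡true

restrictPT-isPseudoTilingOn : (K : ColorSet n) (T : PT n) →
  IsPseudoTilingOn K (restrictPT K T)
restrictPT-isPseudoTilingOn K T a b c _ _ t∧abc =
  let abc = ∧-elimʳ {T a b c} t∧abc ; bc = ∧-elimʳ {K a} abc in
  ∧-elimˡ {K a} abc , ∧-elimˡ {K b} bc , ∧-elimʳ {K b} bc

stick : PT n → Fin n → Fin n → Fin n → Fin n → Str4
stick T i j k l = str (T i j k) (T i j l) (T i k l) (T j k l)

SticksAllowedOn : ColorSet n → PT n → Set
SticksAllowedOn {n} K T = (i j k l : Fin n) → i < j → j < k → k < l →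
  K i ≡ true → K j ≡ true → K k ≡ true → K l ≡ true →
  stick T i j k l ∈ allowedStrings

IsTilingOn-cong : {K : ColorSet n} {S T : PT n} → (∀ a b c → S a b c ≡ T a b c) →
  IsTilingOn K S → IsTilingOn K T
IsTilingOn-cong {S = S} {T} S≗T (pseudo , sticks) =
  (λ a b c a<b b<c t → pseudo a b c a<b b<c (trans (S≗T a b c) t)) ,
  (λ a b c d a<b b<c c<d ka kb kc kd →
    subst (_∈ allowedStrings) (stick-cong a b c d) (sticks a b c d a<b b<c c<d ka kb kc kd))
  where
  stick-cong : ∀ a b c d → stick S a b c d ≡ stick T a b c d
  stick-cong a b c d rewrite S≗T a b c | S≗T a b d | S≗T a c d | S≗T b c d = refl

SticksAllowedOn-mono : {K L : ColorSet n} {T : PT n} → K ⊆ L →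
  SticksAllowedOn L T → SticksAllowedOn K T
SticksAllowedOn-mono K⊆L sticks i j k l i<j j<k k<l ki kj kk kl =
  sticks i j k l i<j j<k k<l (K⊆L i ki) (K⊆L j kj) (K⊆L k kk) (K⊆L l kl)

stick-restrictPT : (K : ColorSet n) (T : PT n) {i j k l : Fin n} →
  K i ≡ true → K j ≡ true → K k ≡ true → K l ≡ true →
  stick (restrictPT K T) i j k l ≡ stick T i j k l
stick-restrictPT K T ki kj kk kl rewrite restrictPT-inside K T ki kj kk
  | restrictPT-inside K T ki kj kl | restrictPT-inside K T ki kk kl
  | restrictPT-inside K T kj kk kl = refl

restrictPT-isTilingOn⇔ : (K : ColorSet n) (T : PT n) →
  SticksAllowedOn K T ⇔ IsTilingOn K (restrictPT K T)
restrictPT-isTilingOn⇔ K T = mk⇔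
  (λ sticks → restrictPT-isPseudoTilingOn K T ,
    λ i j k l i<j j<k k<l ki kj kk kl →
      subst (_∈ allowedStrings) (sym (stick-restrictPT K T ki kj kk kl))
        (sticks i j k l i<j j<k k<l ki kj kk kl))
  (λ (_ , sticks) i j k l i<j j<k k<l ki kj kk kl →
    subst (_∈ allowedStrings) (stick-restrictPT K T ki kj kk kl)
      (sticks i j k l i<j j<k k<l ki kj kk kl))

≟-diag : (x : Fin n) → ⌊ x Fin.≟ x ⌋ ≡ true
≟-diag x = trans (isYes≗does (x Fin.≟ x)) (dec-true (x Fin.≟ x) refl)

module _ (i j k l : Fin n) where

  quad-∋₁ : quad i j k l i ≡ true
  quad-∋₁ rewrite ≟-diag i = refl

  quad-∋₂ : quad i j k l j ≡ true
  quad-∋₂ rewrite ≟-diag j = ∨-zeroʳ _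

  quad-∋₃ : quad i j k l k ≡ true
  quad-∋₃ rewrite ≟-diag k | ∨-zeroʳ ⌊ k Fin.≟ j ⌋ = ∨-zeroʳ _

  quad-∋₄ : quad i j k l l ≡ true
  quad-∋₄ rewrite ≟-diag l | ∨-zeroʳ ⌊ l Fin.≟ k ⌋ | ∨-zeroʳ ⌊ l Fin.≟ j ⌋ = ∨-zeroʳ _

proposition1 : (n : ℕ) → 4 ≤ n → (D : SuperDomain n) →
    ((T : PT n) → D T → IsTiling T) →
    (IsCSDOn allColors D ⇔
      ((i j k l : Fin n) → i < j → j < k → k < l →
        IsCSDOn (quad i j k l) (restrictSD (quad i j k l) D)))
proposition1 n _ D _ = mk⇔ global⇒local local⇒global
  where
  global⇒local : IsCSDOn allColors D → (i j k l : Fin n) → i < j → j < k → k < l →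
    IsCSDOn (quad i j k l) (restrictSD (quad i j k l) D)
  global⇒local csd i j k l _ _ _ m odd Ts Ts∈D|F =
    IsTilingOn-cong majority≗ (Equivalence.to (restrictPT-isTilingOn⇔ F (sm m Us)) sticks)
    where
    F : ColorSet n
    F = quad i j k l
    Us : Fin m → PT n
    Us v = proj₁ (Ts∈D|F v)
    Us∈D : ∀ v → D (Us v)
    Us∈D v = proj₁ (proj₂ (Ts∈D|F v))
    Ts≡F∩Us : ∀ v → Ts v ≡ restrictPT F (Us v)
    Ts≡F∩Us v = proj₂ (proj₂ (Ts∈D|F v))
    sticks : SticksAllowedOn F (sm m Us)
    sticks = SticksAllowedOn-mono (λ _ _ → refl) (proj₂ (csd m odd Us Us∈D))
    majority≗ : ∀ a b c → restrictPT F (sm m Us) a b c ≡ sm m Ts a b c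
    majority≗ a b c = trans (sym (sm-restrictPT F Us a b c))
      (majority-cong _ _ (λ v → cong (λ T → T a b c) (sym (Ts≡F∩Us v))))

  local⇒global : ((i j k l : Fin n) → i < j → j < k → k < l →
    IsCSDOn (quad i j k l) (restrictSD (quad i j k l) D)) → IsCSDOn allColors D
  local⇒global csd m odd Ts Ts∈D = (λ _ _ _ _ _ _ → refl , refl , refl) , sticks
    where
    sticks : SticksAllowedOn allColors (sm m Ts)
    sticks i j k l i<j j<k k<l _ _ _ _ =
      Equivalence.from (restrictPT-isTilingOn⇔ F (sm m Ts))
        (IsTilingOn-cong (sm-restrictPT F Ts) restricted)
        i j k l i<j j<k k<l (quad-∋₁ i j k l) (quad-∋₂ i j k l) (quad-∋₃ i j k l) (quad-∋₄ i j k l)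
      where
      F : ColorSet n
      F = quad i j k l
      restricted : IsTilingOn F (sm m (λ v → restrictPT F (Ts v)))
      restricted = csd i j k l i<j j<k k<l m odd _ (λ v → Ts v , Ts∈D v , refl)
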